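{- For every positive integer $n$, $i(n) \ge \dfrac{n}{56} - 1$.
   Context: An irreducible pair of partitions of $n$ is an (unordered) pair of partitions $\lambda=(\lambda_1,\dots,\lambda_r)$ and $\mu=(\mu_1,\dots,\mu_s)$ of $n$ that yield the same multinomial coefficient, i.e. $\lambda_1!\cdots\lambda_r! = \mu_1!\cdots\mu_s!$, and have no part in common. $i(n)$ is the total number of irreducible pairs of partitions of $n$. -}

module Defs where

open import Data.Nat using (ℕ; zero; suc; _∸_; _≡ᵇ_; _≤ᵇ_)
open import Data.Nat using (_!)
open import Data.Nat.ListAction using (product)
open import Data.List using (List; []; _∷_; [_]; _++_; map; length; filter; concatMap)
open import Data.Bool.ListAction using (any)
open import Data.Bool using (Bool; true; false; if_then_else_; not; _∧_)
open import Data.Product using (_×_; _,_)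
open import Relation.Nullary.Decidable using (Dec; yes; no)
open import Relation.Binary.PropositionalEquality using (_≡_)
open import Data.Bool using (T)
open import Relation.Nullary.Decidable using (T?)

-- A partition of n is represented as a weakly decreasing list of
-- positive integers summing to n.

-- pb f n m : all partitions of n all of whose parts are ≤ m
-- (f is fuel, which is sufficient whenever f ≥ n; each part is ≥ 1).
pb : ℕ → ℕ → ℕ → List (List ℕ)
pb _ zero _ = [ [] ]
pb zero (suc n) _ = []
pb (suc f) (suc n) zero = []
pb (suc f) (suc n) (suc m) =
  pb (suc f) (suc n) m ++
  (if suc m ≤ᵇ suc n then map (suc m ∷_) (pb f (suc n ∸ suc m) (suc m)) else [])

partitions : ℕ → List (List ℕ)
partitions n = pb n n n

factProd : List ℕ → ℕ
factProd λs = product (map _! λs)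

haveCommonPart : List ℕ → List ℕ → Bool
haveCommonPart λs μs = any (λ x → any (λ y → x ≡ᵇ y) μs) λs

isIrreduciblePair : List ℕ → List ℕ → Bool
isIrreduciblePair λs μs = (factProd λs ≡ᵇ factProd μs) ∧ not (haveCommonPart λs μs)

unorderedPairs : {A : Set} → List A → List (A × A)
unorderedPairs [] = []
unorderedPairs (x ∷ xs) = map (x ,_) xs ++ unorderedPairs xs

i : ℕ → ℕ
i n = length (filter (λ p → T? (isIrr p)) (unorderedPairs (partitions n)))
  where
  isIrr : List ℕ × List ℕ → Bool
  isIrr (λs , μs) = isIrreduciblePair λs μs

-- For c, d, t the partitions
--   μ = (2c+1, 2d+1, c+1, d+1, 3ᵗ, 2^(2t+2))   and   λ = (2c+2, 2d+2, c, d, 4ᵗ, 1^(3t+4))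
-- of 3(c + d) + 8 + 7t have the same product of factorials, because (2c+2)! c! = 2 (2c+1)! (c+1)!
-- and 3!ᵗ 2!^(2t+2) = 4 · 4!ᵗ. When 4 ≤ d and d + 2 ≤ c ≤ 2d the twelve values of μ and λ
-- interleave, so the pair has no common part. Sliding (c, d) to (c + j, d − j) keeps the size, and
-- since every integer ≥ 18 is a sum of 6s, 7s and 9s, each n ≥ 56 + 18k admits k + 1 such
-- pairs; hence i(n) ≥ ⌈n/56⌉ − 1.
module Submission where

open import Defs
open import Data.Bool using (Bool; true; false; T; if_then_else_)
import Data.Bool as Bool
open import Data.Bool.Properties using (T-∧; T-≡; T-not-≡; ¬-not)
open import Data.Nat using (ℕ; zero; suc; _+_; _*_; _∸_; _^_; _!; _≤_; _<_; _≤?_; _≤ᵇ_; _≤′_; ≤′-refl; ≤′-step; z≤n; s≤s)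
open import Data.Nat.DivMod using (_/_; _%_; m/n*n≤m; m≡m%n+[m/n]*n; m%n<n)
open import Data.Nat.ListAction using (sum; product)
open import Data.Nat.ListAction.Properties using (sum-++; product-++)
open import Data.Nat.Properties
open import Data.Nat.Tactic.RingSolver using (solve-∀)
open import Data.List using (List; []; _∷_; _++_; map; filter; replicate; upTo; length)
open import Data.List.Properties using (++-assoc; ++-identityʳ; length-++-sucʳ; length-map; length-upTo; map-++; map-replicate)
open import Data.List.Membership.Propositional using (_∈_; find)
open import Data.List.Membership.Propositional.Properties
  using (∈-∃++; ∈-++⁻; ∈-++⁺ˡ; ∈-++⁺ʳ; ∈-map⁺; ∈-map⁻; ∈-filter⁺; ∈-filter⁻; ∈-upTo⁻)
open import Data.List.Relation.Unary.Any using (here; there)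
open import Data.List.Relation.Unary.Any.Properties using (any⁻)
open import Data.List.Relation.Unary.All as All using (All; []; _∷_)
open import Data.List.Relation.Unary.All.Properties using (++⁺; replicate⁺)
open import Data.List.Relation.Unary.AllPairs using (AllPairs; []; _∷_)
open import Data.List.Relation.Unary.Linked using (Linked; [-]; _∷_)
open import Data.List.Relation.Unary.Linked.Properties using (Linked⇒AllPairs)
open import Data.List.Relation.Unary.Unique.Propositional using (Unique)
open import Data.List.Relation.Unary.Unique.Propositional.Properties using (map⁺; upTo⁺)
open import Data.List.Relation.Binary.Subset.Propositional using (_⊆_)
open import Data.List.Relation.Binary.Disjoint.Propositional using (Disjoint)
open import Data.Product using (_×_; _,_; proj₁; proj₂; uncurry; ∃-syntax)
open import Data.Sum using (inj₁; inj₂)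
open import Function using (_∘_)
open import Function.Bundles using (Equivalence)
open import Relation.Nullary using (¬_; yes; no; contradiction)
open import Relation.Nullary.Decidable using (T?)
open import Relation.Binary.PropositionalEquality using (_≡_; _≢_; refl; sym; trans; cong; cong₂; subst; module ≡-Reasoning)

∈-++-∷⁻ : {A : Set} (xs : List A) {ys : List A} {x y : A} → y ≢ x → y ∈ xs ++ x ∷ ys → y ∈ xs ++ ys
∈-++-∷⁻ xs y≢x y∈ with ∈-++⁻ xs y∈
... | inj₁ y∈xs = ∈-++⁺ˡ y∈xs
... | inj₂ (here y≡x) = contradiction y≡x y≢x
... | inj₂ (there y∈ys) = ∈-++⁺ʳ xs y∈ys

Unique-⊆⇒length≤ : {A : Set} {xs ys : List A} → Unique xs → xs ⊆ ys → length xs ≤ length ys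
Unique-⊆⇒length≤ {xs = []} [] _ = z≤n
Unique-⊆⇒length≤ {xs = x ∷ xs} (x∉xs ∷ uniq) x∷xs⊆ys with ∈-∃++ (x∷xs⊆ys (here refl))
... | ys₁ , ys₂ , refl =
  subst (suc (length xs) ≤_) (sym (length-++-sucʳ ys₁ x ys₂)) (s≤s (Unique-⊆⇒length≤ uniq xs⊆ys₁++ys₂))
  where
  xs⊆ys₁++ys₂ : xs ⊆ ys₁ ++ ys₂
  xs⊆ys₁++ys₂ y∈xs = ∈-++-∷⁻ ys₁ (All.lookup x∉xs y∈xs ∘ sym) (x∷xs⊆ys (there y∈xs))

data Decreasing : ℕ → List ℕ → Set where
  [] : ∀ {m} → Decreasing m []
  cons : ∀ {m x xs} → 1 ≤ x → x ≤ m → Decreasing x xs → Decreasing m (x ∷ xs)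

Decreasing-weaken : ∀ {m m' xs} → m ≤ m' → Decreasing m xs → Decreasing m' xs
Decreasing-weaken _ [] = []
Decreasing-weaken m≤m' (cons 1≤x x≤m d) = cons 1≤x (≤-trans x≤m m≤m') d

Decreasing-replicate : ∀ t {m x} → 1 ≤ x → x ≤ m → Decreasing m (replicate t x)
Decreasing-replicate zero _ _ = []
Decreasing-replicate (suc t) 1≤x x≤m = cons 1≤x x≤m (Decreasing-replicate t 1≤x ≤-refl)

Decreasing-replicate-++ : ∀ t {m x xs} → 1 ≤ x → x ≤ m → Decreasing x xs → Decreasing m (replicate t x ++ xs)
Decreasing-replicate-++ zero _ x≤m d = Decreasing-weaken x≤m d
Decreasing-replicate-++ (suc t) 1≤x x≤m d = cons 1≤x x≤m (Decreasing-replicate-++ t 1≤x ≤-refl d)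

pbBlock : ℕ → ℕ → ℕ → List (List ℕ)
pbBlock f n m = if suc m ≤ᵇ suc n then map (suc m ∷_) (pb f (suc n ∸ suc m) (suc m)) else []

∈-pbBlock : ∀ {f n m xs} → m ≤ n → xs ∈ pb f (n ∸ m) (suc m) → suc m ∷ xs ∈ pbBlock f n m
∈-pbBlock {f} {n} {m} m≤n xs∈ with suc m ≤ᵇ suc n | ≤⇒≤ᵇ (s≤s m≤n)
... | true | _ = ∈-map⁺ (suc m ∷_) xs∈

∈-pb : ∀ f n m {xs} → Decreasing m xs → sum xs ≡ n → n ≤ f → xs ∈ pb f n m
∈-pb f .0 m [] refl _ = here refl
∈-pb f n zero (cons (s≤s _) () _) _ _
∈-pb f zero (suc m) (cons (s≤s _) _ _) () _
∈-pb zero (suc n) (suc m) (cons _ _ _) _ ()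
∈-pb (suc f) (suc n) (suc m) (cons 1≤x x≤1+m d) s n≤f with m≤n⇒m<n∨m≡n x≤1+m
... | inj₁ (s≤s x≤m) = ∈-++⁺ˡ (∈-pb (suc f) (suc n) m (cons 1≤x x≤m d) s n≤f)
∈-pb (suc f) (suc n) (suc m) {_ ∷ xs} (cons _ _ d) refl n≤f | inj₂ refl =
  ∈-++⁺ʳ (pb (suc f) (suc n) m)
    (∈-pbBlock (m≤m+n m (sum xs))
      (∈-pb f (m + sum xs ∸ m) (suc m) d (sym (m+n∸m≡n m (sum xs))) (≤-trans (m∸n≤m _ m) (≤-pred n≤f))))

pb-prefix : ∀ f n {a m} → a ≤′ m → ∃[ zs ] pb f n m ≡ pb f n a ++ zs
pb-prefix f n ≤′-refl = [] , sym (++-identityʳ _)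
pb-prefix f zero (≤′-step _) = [] , refl
pb-prefix zero (suc n) (≤′-step _) = [] , refl
pb-prefix (suc f) (suc n) {a} (≤′-step {m} a≤m) =
  let zs , eq = pb-prefix (suc f) (suc n) a≤m
  in zs ++ pbBlock f n m , trans (cong (_++ pbBlock f n m) eq) (++-assoc (pb (suc f) (suc n) a) zs _)

∈-unorderedPairs-++ : {A : Set} (xs ys : List A) {x y : A} → x ∈ xs → y ∈ ys → (x , y) ∈ unorderedPairs (xs ++ ys)
∈-unorderedPairs-++ (x ∷ xs) ys (here refl) y∈ys = ∈-++⁺ˡ (∈-map⁺ (x ,_) (∈-++⁺ʳ xs y∈ys))
∈-unorderedPairs-++ (x ∷ xs) ys (there x∈xs) y∈ys =
  ∈-++⁺ʳ (map (x ,_) (xs ++ ys)) (∈-unorderedPairs-++ xs ys x∈xs y∈ys)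

-- pb lists partitions by increasing largest part, so a partition with smaller largest part comes first.
pair-∈-partitions : ∀ {m xs ys} → Decreasing m xs → Decreasing (suc m) ys → sum xs ≡ sum (suc m ∷ ys) →
  (xs , suc m ∷ ys) ∈ unorderedPairs (partitions (sum (suc m ∷ ys)))
pair-∈-partitions {m} {xs} {ys} dxs dys xs≡ =
  subst (λ L → (xs , suc m ∷ ys) ∈ unorderedPairs L) (sym (trans split (++-assoc smaller larger rest)))
    (∈-unorderedPairs-++ smaller (larger ++ rest)
      (∈-pb (suc n) (suc n) m dxs xs≡ ≤-refl)
      (∈-++⁺ˡ (∈-pbBlock (m≤m+n m (sum ys)) (∈-pb n (n ∸ m) (suc m) dys (sym (m+n∸m≡n m (sum ys))) (m∸n≤m n m)))))
  where
  n = m + sum ys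
  smaller = pb (suc n) (suc n) m
  larger = pbBlock n n m
  prefix = pb-prefix (suc n) (suc n) (≤⇒≤′ (s≤s (m≤m+n m (sum ys))))
  rest = proj₁ prefix
  split = proj₂ prefix

-- i n is definitionally length (irreduciblePairs n).
irreduciblePairs : ℕ → List (List ℕ × List ℕ)
irreduciblePairs n = filter (λ p → T? (uncurry isIrreduciblePair p)) (unorderedPairs (partitions n))

Disjoint⇒¬haveCommonPart : ∀ {xs ys} → Disjoint xs ys → ¬ T (haveCommonPart xs ys)
Disjoint⇒¬haveCommonPart {xs} {ys} xs#ys common =
  let x , x∈xs , x∈ys? = find (any⁻ _ xs common)
      y , y∈ys , x≡ᵇy = find (any⁻ _ ys x∈ys?)
  in xs#ys (x∈xs , subst (_∈ ys) (sym (≡ᵇ⇒≡ x y x≡ᵇy)) y∈ys)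

isIrreduciblePair-intro : ∀ {xs ys} → factProd xs ≡ factProd ys → Disjoint xs ys → T (isIrreduciblePair xs ys)
isIrreduciblePair-intro eq xs#ys = Equivalence.from T-∧
  (≡⇒≡ᵇ _ _ eq , Equivalence.from T-not-≡ (¬-not (Disjoint⇒¬haveCommonPart xs#ys ∘ Equivalence.from T-≡)))

-- A list of tagged numbers descending under ≽ repeats a value only inside one tag.
_≽_ : Bool × ℕ → Bool × ℕ → Set
(p , x) ≽ (q , y) = y ≤ x × (p ≢ q → y < x)

≽-strict : ∀ {p q x y} → y < x → (p , x) ≽ (q , y)
≽-strict y<x = <⇒≤ y<x , λ _ → y<x

≽-same : ∀ {p x y} → y ≤ x → (p , x) ≽ (p , y)
≽-same y≤x = y≤x , λ p≢p → contradiction refl p≢p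

≽-trans : ∀ {a b c} → a ≽ b → b ≽ c → a ≽ c
≽-trans {p , x} {q , y} {r , z} (y≤x , y<x) (z≤y , z<y) = ≤-trans z≤y y≤x , z<x
  where
  z<x : p ≢ r → z < x
  z<x p≢r with p Bool.≟ q
  ... | yes refl = <-≤-trans (z<y p≢r) y≤x
  ... | no p≢q = ≤-<-trans z≤y (y<x p≢q)

valuesOn : Bool → List (Bool × ℕ) → List ℕ
valuesOn p zs = map proj₂ (filter (λ z → proj₁ z Bool.≟ p) zs)

∈-valuesOn⁻ : ∀ {p x} zs → x ∈ valuesOn p zs → (p , x) ∈ zs
∈-valuesOn⁻ {p} zs x∈ with ∈-map⁻ proj₂ x∈
... | (q , x) , z∈ , refl with ∈-filter⁻ (λ z → proj₁ z Bool.≟ p) {xs = zs} z∈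
... | z∈zs , refl = z∈zs

AllPairs-≽⇒≢ : ∀ {zs p q x y} → AllPairs _≽_ zs → (p , x) ∈ zs → (q , y) ∈ zs → p ≢ q → x ≢ y
AllPairs-≽⇒≢ (_ ∷ _) (here refl) (here refl) p≢q = contradiction refl p≢q
AllPairs-≽⇒≢ (above ∷ _) (here refl) (there y∈) p≢q = >⇒≢ (proj₂ (All.lookup above y∈) p≢q)
AllPairs-≽⇒≢ (above ∷ _) (there x∈) (here refl) p≢q = <⇒≢ (proj₂ (All.lookup above x∈) (p≢q ∘ sym))
AllPairs-≽⇒≢ (_ ∷ ps) (there x∈) (there y∈) p≢q = AllPairs-≽⇒≢ ps x∈ y∈ p≢q

Linked-≽⇒Disjoint : ∀ {zs} → Linked _≽_ zs → Disjoint (valuesOn false zs) (valuesOn true zs)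
Linked-≽⇒Disjoint {zs} descends (x∈ , y∈) =
  AllPairs-≽⇒≢ (Linked⇒AllPairs ≽-trans descends) (∈-valuesOn⁻ zs x∈) (∈-valuesOn⁻ zs y∈) (λ ()) refl

^-distrib-* : ∀ m n t → (m * n) ^ t ≡ m ^ t * n ^ t
^-distrib-* m n zero = refl
^-distrib-* m n (suc t) = trans (cong (m * n *_) (^-distrib-* m n t)) (interchange m n (m ^ t) (n ^ t))
  where
  interchange : ∀ a b x y → a * b * (x * y) ≡ a * x * (b * y)
  interchange = solve-∀

sum-replicate : ∀ t x → sum (replicate t x) ≡ t * x
sum-replicate zero x = refl
sum-replicate (suc t) x = cong (x +_) (sum-replicate t x)

sum-replicate-++ : ∀ t x r y → sum (replicate t x ++ replicate r y) ≡ t * x + r * y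
sum-replicate-++ t x r y = trans (sum-++ (replicate t x) _) (cong₂ _+_ (sum-replicate t x) (sum-replicate r y))

product-replicate : ∀ t x → product (replicate t x) ≡ x ^ t
product-replicate zero x = refl
product-replicate (suc t) x = cong (x *_) (product-replicate t x)

factProd-++ : ∀ xs ys → factProd (xs ++ ys) ≡ factProd xs * factProd ys
factProd-++ xs ys = trans (cong product (map-++ _! xs ys)) (product-++ (map _! xs) (map _! ys))

factProd-replicate : ∀ t x → factProd (replicate t x) ≡ (x !) ^ t
factProd-replicate t x = trans (cong product (map-replicate _! t x)) (product-replicate t (x !))

factProd-replicate-++ : ∀ t x r y → factProd (replicate t x ++ replicate r y) ≡ (x !) ^ t * (y !) ^ r
factProd-replicate-++ t x r y =
  trans (factProd-++ (replicate t x) _) (cong₂ _*_ (factProd-replicate t x) (factProd-replicate r y))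

factorial-doubling : ∀ c → (2 + 2 * c) ! * c ! ≡ 2 * ((1 + 2 * c) ! * (1 + c) !)
factorial-doubling c = regroup c ((1 + 2 * c) !) (c !)
  where
  regroup : ∀ c x y → (2 + 2 * c) * x * y ≡ 2 * (x * ((1 + c) * y))
  regroup = solve-∀

μ-filler λ-filler : ℕ → List ℕ
μ-filler t = replicate t 3 ++ replicate (2 + 2 * t) 2
λ-filler t = replicate t 4 ++ replicate (4 + 3 * t) 1

factProd-μ-filler : ∀ t → factProd (μ-filler t) ≡ 4 * 24 ^ t
factProd-μ-filler t = begin
  factProd (μ-filler t)           ≡⟨ factProd-replicate-++ t 3 (2 + 2 * t) 2 ⟩
  6 ^ t * (2 * (2 * 2 ^ (2 * t))) ≡⟨ cong (λ x → 6 ^ t * (2 * (2 * x))) (sym (^-*-assoc 2 2 t)) ⟩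
  6 ^ t * (2 * (2 * 4 ^ t))       ≡⟨ regroup (6 ^ t) (4 ^ t) ⟩
  4 * (6 ^ t * 4 ^ t)             ≡⟨ cong (4 *_) (sym (^-distrib-* 6 4 t)) ⟩
  4 * 24 ^ t                      ∎
  where
  open ≡-Reasoning
  regroup : ∀ x y → x * (2 * (2 * y)) ≡ 4 * (x * y)
  regroup = solve-∀

factProd-λ-filler : ∀ t → factProd (λ-filler t) ≡ 24 ^ t
factProd-λ-filler t =
  trans (factProd-replicate-++ t 4 (4 + 3 * t) 1) (trans (cong (24 ^ t *_) (^-zeroˡ (4 + 3 * t))) (*-identityʳ (24 ^ t)))

gadgetμ gadgetλ : ℕ → ℕ → ℕ → List ℕ
gadgetμ c d t = 1 + 2 * c ∷ 1 + 2 * d ∷ 1 + c ∷ 1 + d ∷ μ-filler t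
gadgetλ c d t = 2 + 2 * c ∷ 2 + 2 * d ∷ c ∷ d ∷ λ-filler t

gadgetPair : ℕ → ℕ → ℕ → List ℕ × List ℕ
gadgetPair c d t = gadgetμ c d t , gadgetλ c d t

factProd-gadget : ∀ c d t → factProd (gadgetμ c d t) ≡ factProd (gadgetλ c d t)
factProd-gadget c d t = begin
  factProd (gadgetμ c d t)
    ≡⟨ cong (λ x → (1 + 2 * c) ! * ((1 + 2 * d) ! * ((1 + c) ! * ((1 + d) ! * x)))) (factProd-μ-filler t) ⟩
  (1 + 2 * c) ! * ((1 + 2 * d) ! * ((1 + c) ! * ((1 + d) ! * (4 * 24 ^ t))))
    ≡⟨ pair-up ((1 + 2 * c) !) ((1 + 2 * d) !) ((1 + c) !) ((1 + d) !) (24 ^ t) ⟩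
  2 * ((1 + 2 * c) ! * (1 + c) !) * (2 * ((1 + 2 * d) ! * (1 + d) !)) * 24 ^ t
    ≡⟨ cong₂ (λ x y → x * y * 24 ^ t) (sym (factorial-doubling c)) (sym (factorial-doubling d)) ⟩
  (2 + 2 * c) ! * c ! * ((2 + 2 * d) ! * d !) * 24 ^ t
    ≡⟨ unpair ((2 + 2 * c) !) ((2 + 2 * d) !) (c !) (d !) (24 ^ t) ⟩
  (2 + 2 * c) ! * ((2 + 2 * d) ! * (c ! * (d ! * 24 ^ t)))
    ≡⟨ cong (λ x → (2 + 2 * c) ! * ((2 + 2 * d) ! * (c ! * (d ! * x)))) (sym (factProd-λ-filler t)) ⟩
  factProd (gadgetλ c d t) ∎
  where
  open ≡-Reasoning
  pair-up : ∀ a b x y z → a * (b * (x * (y * (4 * z)))) ≡ 2 * (a * x) * (2 * (b * y)) * z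
  pair-up = solve-∀
  unpair : ∀ a b x y z → a * x * (b * y) * z ≡ a * (b * (x * (y * z)))
  unpair = solve-∀

sum-gadgetμ : ∀ c d t → sum (gadgetμ c d t) ≡ 3 * (c + d) + 8 + 7 * t
sum-gadgetμ c d t =
  trans (cong (λ x → 1 + 2 * c + (1 + 2 * d + (1 + c + (1 + d + x)))) (sum-replicate-++ t 3 (2 + 2 * t) 2)) (collect c d t)
  where
  collect : ∀ c d t → 1 + 2 * c + (1 + 2 * d + (1 + c + (1 + d + (t * 3 + (2 + 2 * t) * 2)))) ≡ 3 * (c + d) + 8 + 7 * t
  collect = solve-∀

sum-gadgetλ : ∀ c d t → sum (gadgetλ c d t) ≡ 3 * (c + d) + 8 + 7 * t
sum-gadgetλ c d t =
  trans (cong (λ x → 2 + 2 * c + (2 + 2 * d + (c + (d + x)))) (sum-replicate-++ t 4 (4 + 3 * t) 1)) (collect c d t)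
  where
  collect : ∀ c d t → 2 + 2 * c + (2 + 2 * d + (c + (d + (t * 4 + (4 + 3 * t) * 1)))) ≡ 3 * (c + d) + 8 + 7 * t
  collect = solve-∀

⊆-distinctParts : ∀ {a b c d e f : ℕ} t r → a ∷ b ∷ c ∷ d ∷ replicate t e ++ replicate r f ⊆ a ∷ b ∷ c ∷ d ∷ e ∷ f ∷ []
⊆-distinctParts {a} {b} {c} {d} {e} {f} t r = All.lookup parts∈
  where
  parts∈ : All (_∈ a ∷ b ∷ c ∷ d ∷ e ∷ f ∷ []) (a ∷ b ∷ c ∷ d ∷ replicate t e ++ replicate r f)
  parts∈ =
    here refl ∷ there (here refl) ∷ there (there (here refl)) ∷ there (there (there (here refl))) ∷
    ++⁺ (replicate⁺ t (there (there (there (there (here refl))))))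
        (replicate⁺ r (there (there (there (there (there (here refl)))))))

-- The distinct parts of gadgetμ (tag false) and of gadgetλ (tag true), in decreasing order.
gadgetChain : ℕ → ℕ → List (Bool × ℕ)
gadgetChain c d =
  (true , 2 + 2 * c) ∷ (false , 1 + 2 * c) ∷ (true , 2 + 2 * d) ∷ (false , 1 + 2 * d) ∷
  (false , 1 + c) ∷ (true , c) ∷ (false , 1 + d) ∷ (true , d) ∷
  (true , 4) ∷ (false , 3) ∷ (false , 2) ∷ (true , 1) ∷ []

gadgetChain-descends : ∀ {c d} → 4 ≤ d → 2 + d ≤ c → c ≤ 2 * d → Linked _≽_ (gadgetChain c d)
gadgetChain-descends {c} {d} 4≤d 2+d≤c c≤2d =
  ≽-strict ≤-refl ∷ ≽-strict (s≤s 2+2d≤2c) ∷ ≽-strict ≤-refl ∷ ≽-same (s≤s c≤2d) ∷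
  ≽-strict ≤-refl ∷ ≽-strict 2+d≤c ∷ ≽-strict ≤-refl ∷ ≽-same 4≤d ∷
  ≽-strict ≤-refl ∷ ≽-same (n≤1+n 2) ∷ ≽-strict ≤-refl ∷ [-]
  where
  2+2d≤2c : 2 + 2 * d ≤ 2 * c
  2+2d≤2c = subst (_≤ 2 * c) (*-distribˡ-+ 2 1 d) (*-monoʳ-≤ 2 (≤-trans (n≤1+n _) 2+d≤c))

gadget-disjoint : ∀ {c d} t → 4 ≤ d → 2 + d ≤ c → c ≤ 2 * d → Disjoint (gadgetμ c d t) (gadgetλ c d t)
gadget-disjoint t 4≤d 2+d≤c c≤2d (x∈μ , x∈λ) =
  Linked-≽⇒Disjoint (gadgetChain-descends 4≤d 2+d≤c c≤2d)
    (⊆-distinctParts t (2 + 2 * t) x∈μ , ⊆-distinctParts t (4 + 3 * t) x∈λ)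

gadgetμ-decreasing : ∀ {c d} t → 4 ≤ d → 2 + d ≤ c → c ≤ 2 * d → Decreasing (1 + 2 * c) (gadgetμ c d t)
gadgetμ-decreasing {c} {d} t 4≤d 2+d≤c c≤2d =
  cons (s≤s z≤n) ≤-refl (cons (s≤s z≤n) (s≤s (*-monoʳ-≤ 2 d≤c)) (cons (s≤s z≤n) (s≤s c≤2d) (cons (s≤s z≤n) (s≤s d≤c)
    (Decreasing-replicate-++ t (s≤s z≤n) (s≤s (≤-trans (s≤s (s≤s z≤n)) 4≤d))
      (Decreasing-replicate (2 + 2 * t) (s≤s z≤n) (n≤1+n 2))))))
  where
  d≤c : d ≤ c
  d≤c = ≤-trans (m≤n+m d 2) 2+d≤c

gadgetλ-tail-decreasing : ∀ {c d} t → 4 ≤ d → 2 + d ≤ c → c ≤ 2 * d →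
  Decreasing (2 + 2 * c) (2 + 2 * d ∷ c ∷ d ∷ λ-filler t)
gadgetλ-tail-decreasing {c} {d} t 4≤d 2+d≤c c≤2d =
  cons (s≤s z≤n) (s≤s (s≤s (*-monoʳ-≤ 2 d≤c))) (cons (≤-trans (s≤s z≤n) 2+d≤c) (≤-trans c≤2d (m≤n+m _ 2))
    (cons (≤-trans (s≤s z≤n) 4≤d) d≤c
      (Decreasing-replicate-++ t (s≤s z≤n) 4≤d (Decreasing-replicate (4 + 3 * t) (s≤s z≤n) (s≤s z≤n)))))
  where
  d≤c : d ≤ c
  d≤c = ≤-trans (m≤n+m d 2) 2+d≤c

gadget-∈-irreduciblePairs : ∀ {c d} t → 4 ≤ d → 2 + d ≤ c → c ≤ 2 * d →
  gadgetPair c d t ∈ irreduciblePairs (3 * (c + d) + 8 + 7 * t)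
gadget-∈-irreduciblePairs {c} {d} t 4≤d 2+d≤c c≤2d =
  ∈-filter⁺ (λ p → T? (uncurry isIrreduciblePair p))
    (subst (λ n → gadgetPair c d t ∈ unorderedPairs (partitions n)) (sum-gadgetλ c d t)
      (pair-∈-partitions (gadgetμ-decreasing t 4≤d 2+d≤c c≤2d) (gadgetλ-tail-decreasing t 4≤d 2+d≤c c≤2d)
        (trans (sum-gadgetμ c d t) (sym (sum-gadgetλ c d t)))))
    (isIrreduciblePair-intro (factProd-gadget c d t) (gadget-disjoint t 4≤d 2+d≤c c≤2d))

gadgetFamily : ℕ → ℕ → ℕ → ℕ → List (List ℕ × List ℕ)
gadgetFamily c d k t = map (λ j → gadgetPair (c + j) (d + (k ∸ j)) t) (upTo (suc k))

gadgetFamily-unique : ∀ c d k t → Unique (gadgetFamily c d k t)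
gadgetFamily-unique c d k t = map⁺ (λ eq → +-cancelˡ-≡ c _ _ (cong (third ∘ proj₂) eq)) (upTo⁺ (suc k))
  where
  third : List ℕ → ℕ
  third (_ ∷ _ ∷ x ∷ _) = x
  third _ = 0

gadgetFamily-⊆ : ∀ {c d k} t → 4 ≤ d → 2 + d + k ≤ c → c + k ≤ 2 * d →
  gadgetFamily c d k t ⊆ irreduciblePairs (3 * (c + d + k) + 8 + 7 * t)
gadgetFamily-⊆ {c} {d} {k} t 4≤d 2+d+k≤c c+k≤2d p∈ with ∈-map⁻ _ p∈
... | j , j∈ , refl =
  subst (λ s → gadgetPair (c + j) (d + (k ∸ j)) t ∈ irreduciblePairs (3 * s + 8 + 7 * t)) sum≡
    (gadget-∈-irreduciblePairs t
      (≤-trans 4≤d (m≤m+n d _))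
      (≤-trans (+-monoʳ-≤ 2 (+-monoʳ-≤ d (m∸n≤m k j))) (≤-trans 2+d+k≤c (m≤m+n c j)))
      (≤-trans (+-monoʳ-≤ c j≤k) (≤-trans c+k≤2d (*-monoʳ-≤ 2 (m≤m+n d _)))))
  where
  j≤k : j ≤ k
  j≤k = ≤-pred (∈-upTo⁻ j∈)
  regroup : ∀ c d j x → c + j + (d + x) ≡ c + d + (j + x)
  regroup = solve-∀
  sum≡ : c + j + (d + (k ∸ j)) ≡ c + d + k
  sum≡ = trans (regroup c d j (k ∸ j)) (cong (c + d +_) (m+[n∸m]≡n j≤k))

-- Stated with g * 6 so that the step g ↦ suc g below is definitional.
eighteen-plus : ∀ x → ∃[ e ] ∃[ g ] ∃[ t ] 18 + x ≡ g * 6 + e * 9 + t * 7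
eighteen-plus 0 = 0 , 3 , 0 , refl
eighteen-plus 1 = 0 , 2 , 1 , refl
eighteen-plus 2 = 0 , 1 , 2 , refl
eighteen-plus 3 = 0 , 0 , 3 , refl
eighteen-plus 4 = 1 , 1 , 1 , refl
eighteen-plus 5 = 1 , 0 , 2 , refl
eighteen-plus (suc (suc (suc (suc (suc (suc x)))))) =
  let e , g , t , eq = eighteen-plus x in e , suc g , t , cong (6 +_) eq

suc-k≤i : ∀ k n → 56 + 18 * k ≤ n → suc k ≤ i n
suc-k≤i k n 56+18k≤n = begin
  suc k                         ≡⟨ sym (trans (length-map _ (upTo (suc k))) (length-upTo (suc k))) ⟩
  length (gadgetFamily c d k t) ≤⟨ Unique-⊆⇒length≤ (gadgetFamily-unique c d k t) family⊆ ⟩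
  length (irreduciblePairs n)   ∎
  where
  open ≤-Reasoning
  excess = m≤n⇒∃[o]m+o≡n 56+18k≤n
  x = proj₁ excess
  coefficients = eighteen-plus x
  e = proj₁ coefficients
  g = proj₁ (proj₂ coefficients)
  t = proj₁ (proj₂ (proj₂ coefficients))
  d = 4 + (2 * k + e + g)
  c = 2 + d + k + e
  twice-d : ∀ k e g → 2 * (4 + (2 * k + e + g)) ≡ 2 + (4 + (2 * k + e + g)) + k + e + k + (2 + g)
  twice-d = solve-∀
  regroup : ∀ k e g t → 3 * (2 + (4 + (2 * k + e + g)) + k + e + (4 + (2 * k + e + g)) + k) + 8 + 7 * t
                      ≡ 38 + 18 * k + (g * 6 + e * 9 + t * 7)
  regroup = solve-∀
  regroup′ : ∀ k x → 38 + 18 * k + (18 + x) ≡ 56 + 18 * k + x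
  regroup′ = solve-∀
  n≡ : 3 * (c + d + k) + 8 + 7 * t ≡ n
  n≡ = trans (regroup k e g t)
         (trans (cong (38 + 18 * k +_) (sym (proj₂ (proj₂ (proj₂ coefficients)))))
           (trans (regroup′ k x) (proj₂ excess)))
  family⊆ : gadgetFamily c d k t ⊆ irreduciblePairs n
  family⊆ = subst (λ m → gadgetFamily c d k t ⊆ irreduciblePairs m) n≡
    (gadgetFamily-⊆ t (m≤m+n 4 _) (m≤m+n (2 + d + k) e) (subst (c + k ≤_) (sym (twice-d k e g)) (m≤m+n (c + k) (2 + g))))

blocks-of-56 : ∀ q → 56 + 18 * (q / 56) ≤ 57 + q × 57 + q ≤ 56 * (suc (q / 56) + 1)
blocks-of-56 q = lower , upper
  where
  open ≤-Reasoning
  k = q / 56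
  lower : 56 + 18 * k ≤ 57 + q
  lower = begin
    56 + 18 * k ≤⟨ +-monoʳ-≤ 56 (*-monoˡ-≤ k (m≤m+n 18 38)) ⟩
    56 + 56 * k ≡⟨ cong (56 +_) (*-comm 56 k) ⟩
    56 + k * 56 ≤⟨ +-monoʳ-≤ 56 (m/n*n≤m q 56) ⟩
    56 + q      <⟨ ≤-refl ⟩
    57 + q      ∎
  upper : 57 + q ≤ 56 * (suc k + 1)
  upper = begin
    57 + q                 ≡⟨ cong (57 +_) (m≡m%n+[m/n]*n q 56) ⟩
    57 + (q % 56 + k * 56) ≤⟨ +-monoʳ-≤ 57 (+-monoˡ-≤ (k * 56) (≤-pred (m%n<n q 56))) ⟩
    57 + (55 + k * 56)     ≡⟨ regroup k ⟩
    56 * (suc k + 1)       ∎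
    where
    regroup : ∀ k → 57 + (55 + k * 56) ≡ 56 * (suc k + 1)
    regroup = solve-∀

theorem13 : (n : ℕ) → 1 ≤ n → n ≤ 56 * (i n + 1)
theorem13 n _ with n ≤? 56
... | yes n≤56 = ≤-trans n≤56 (*-monoʳ-≤ 56 (m≤n+m 1 (i n)))
... | no n≰56 = subst (_≤ 56 * (i n + 1)) 57+q≡n (≤-trans upper (*-monoʳ-≤ 56 (+-monoˡ-≤ 1 k<i)))
  where
  q = proj₁ (m≤n⇒∃[o]m+o≡n (≰⇒> n≰56))
  57+q≡n = proj₂ (m≤n⇒∃[o]m+o≡n (≰⇒> n≰56))
  lower = proj₁ (blocks-of-56 q)
  upper = proj₂ (blocks-of-56 q)
  k<i : suc (q / 56) ≤ i n
  k<i = suc-k≤i (q / 56) n (subst (56 + 18 * (q / 56) ≤_) 57+q≡n lower)
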